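{- Let $G_1$ and $G_2$ be $2$-cographs with disjoint vertex sets and let $G$ be a $0$-sum or a $1$-sum of $G_1$ and $G_2$. Then $G$ is a $2$-cograph.
   Context: All graphs are finite and simple; $\overline{G}$ denotes the complement of $G$. A graph is $2$-connected if it has at least three vertices, is connected, and has no cut vertex. A graph $G$ is a $2$-cograph if $G$ has no induced subgraph $H$ such that both $H$ and $\overline{H}$ are $2$-connected. For graphs $G_1,G_2$ with disjoint vertex sets, the $0$-sum of $G_1$ and $G_2$ is their disjoint union, and a $1$-sum of $G_1$ and $G_2$ is a graph obtained from their disjoint union by identifying a vertex of $G_1$ with a vertex of $G_2$. -}

module Defs where

open import Data.Nat using (ℕ; zero; suc; _+_; _≤_)
open import Data.Fin using (Fin; punchIn; splitAt; _≟_)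
open import Data.Fin.Properties using (punchInᵢ≢i)
open import Data.Bool using (Bool; true; false; not; if_then_else_; _∨_)
open import Data.Sum using (_⊎_; inj₁; inj₂)
open import Data.Product using (Σ; ∃; _×_; _,_)
open import Relation.Nullary using (¬_; does; yes; no)
open import Relation.Binary.PropositionalEquality using (_≡_; _≢_; refl; sym; trans; cong)
open import Function.Definitions using (Injective)

record Graph (n : ℕ) : Set where
  field
    adj    : Fin n → Fin n → Bool
    adj-sym    : ∀ i j → adj i j ≡ adj j i
    adj-irrefl : ∀ i → adj i i ≡ false
open Graph public

complement : ∀ {n} → Graph n → Graph n
complement {n} G = record { adj = a ; adj-sym = s ; adj-irrefl = ir }
  where
  a : Fin n → Fin n → Bool
  a i j = if does (i ≟ j) then false else not (adj G i j)
  s : ∀ i j → a i j ≡ a j i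
  s i j with i ≟ j | j ≟ i
  ... | yes _ | yes _ = refl
  ... | yes p | no q = Data.Empty.⊥-elim (q (sym p)) where import Data.Empty
  ... | no p | yes q = Data.Empty.⊥-elim (p (sym q)) where import Data.Empty
  ... | no _ | no _ = cong not (adj-sym G i j)
  ir : ∀ i → a i i ≡ false
  ir i with i ≟ i
  ... | yes _ = refl
  ... | no p = Data.Empty.⊥-elim (p refl) where import Data.Empty

induced : ∀ {m n} → Graph n → (Fin m → Fin n) → Graph m
induced G f = record
  { adj = λ i j → adj G (f i) (f j)
  ; adj-sym = λ i j → adj-sym G (f i) (f j)
  ; adj-irrefl = λ i → adj-irrefl G (f i) }

delete : ∀ {m} → Graph (suc m) → Fin (suc m) → Graph m
delete G v = induced G (punchIn v)

data Reachable {n} (G : Graph n) : Fin n → Fin n → Set where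
  here : ∀ {u} → Reachable G u u
  step : ∀ {u v w} → adj G u v ≡ true → Reachable G v w → Reachable G u w

Connected : ∀ {n} → Graph n → Set
Connected {n} G = (u v : Fin n) → Reachable G u v

-- v is a cut vertex: deleting v increases the number of components, i.e. there
-- are two vertices u, w ≠ v joined in G but not in G - v.
CutVertex : ∀ {m} → Graph (suc m) → Fin (suc m) → Set
CutVertex {m} G v =
  Σ (Fin m) λ u → Σ (Fin m) λ w →
    Reachable G (punchIn v u) (punchIn v w) × ¬ Reachable (delete G v) u w

TwoConnected : ∀ {n} → Graph n → Set
TwoConnected {zero} G = Data.Empty.⊥ where import Data.Empty
TwoConnected {suc m} G = 3 ≤ suc m × Connected G × ((v : Fin (suc m)) → ¬ CutVertex G v)

TwoCograph : ∀ {n} → Graph n → Set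
TwoCograph {n} G =
  ¬ (Σ ℕ λ m → Σ (Fin m → Fin n) λ f →
       Injective _≡_ _≡_ f × TwoConnected (induced G f) × TwoConnected (complement (induced G f)))

zeroSum : ∀ {n₁ n₂} → Graph n₁ → Graph n₂ → Graph (n₁ + n₂)
zeroSum {n₁} {n₂} G₁ G₂ = record { adj = a ; adj-sym = s ; adj-irrefl = ir }
  where
  a' : Fin n₁ ⊎ Fin n₂ → Fin n₁ ⊎ Fin n₂ → Bool
  a' (inj₁ i) (inj₁ j) = adj G₁ i j
  a' (inj₂ i) (inj₂ j) = adj G₂ i j
  a' _ _ = false
  a : Fin (n₁ + n₂) → Fin (n₁ + n₂) → Bool
  a i j = a' (splitAt n₁ i) (splitAt n₁ j)
  s' : ∀ x y → a' x y ≡ a' y x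
  s' (inj₁ i) (inj₁ j) = adj-sym G₁ i j
  s' (inj₁ i) (inj₂ j) = refl
  s' (inj₂ i) (inj₁ j) = refl
  s' (inj₂ i) (inj₂ j) = adj-sym G₂ i j
  s : ∀ i j → a i j ≡ a j i
  s i j = s' (splitAt n₁ i) (splitAt n₁ j)
  ir' : ∀ x → a' x x ≡ false
  ir' (inj₁ i) = adj-irrefl G₁ i
  ir' (inj₂ i) = adj-irrefl G₂ i
  ir : ∀ i → a i i ≡ false
  ir i = ir' (splitAt n₁ i)

-- Vertices Fin (n₁ + m₂):
-- the first n₁ are the vertices of G₁ (x playing the role of the merged vertex),
-- the remaining m₂ are the vertices of G₂ other than y (embedded by punchIn y).
oneSum : ∀ {n₁ m₂} → Graph n₁ → Graph (suc m₂) → Fin n₁ → Fin (suc m₂) → Graph (n₁ + m₂)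
oneSum {n₁} {m₂} G₁ G₂ x y = record { adj = a ; adj-sym = s ; adj-irrefl = ir }
  where
  a' : Fin n₁ ⊎ Fin m₂ → Fin n₁ ⊎ Fin m₂ → Bool
  a' (inj₁ i) (inj₁ j) = adj G₁ i j
  a' (inj₂ i) (inj₂ j) = adj G₂ (punchIn y i) (punchIn y j)
  a' (inj₁ i) (inj₂ j) = if does (i ≟ x) then adj G₂ y (punchIn y j) else false
  a' (inj₂ i) (inj₁ j) = if does (j ≟ x) then adj G₂ (punchIn y i) y else false
  a : Fin (n₁ + m₂) → Fin (n₁ + m₂) → Bool
  a i j = a' (splitAt n₁ i) (splitAt n₁ j)
  s' : ∀ u v → a' u v ≡ a' v u
  s' (inj₁ i) (inj₁ j) = adj-sym G₁ i j
  s' (inj₂ i) (inj₂ j) = adj-sym G₂ (punchIn y i) (punchIn y j)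
  s' (inj₁ i) (inj₂ j) with does (i ≟ x)
  ... | true = adj-sym G₂ y (punchIn y j)
  ... | false = refl
  s' (inj₂ i) (inj₁ j) with does (j ≟ x)
  ... | true = adj-sym G₂ (punchIn y i) y
  ... | false = refl
  s : ∀ i j → a i j ≡ a j i
  s i j = s' (splitAt n₁ i) (splitAt n₁ j)
  ir' : ∀ u → a' u u ≡ false
  ir' (inj₁ i) = adj-irrefl G₁ i
  ir' (inj₂ i) = adj-irrefl G₂ (punchIn y i)
  ir : ∀ i → a i i ≡ false
  ir i = ir' (splitAt n₁ i)

-- An obstruction H (H and its complement 2-connected) is connected, so in a 0-sum it lies
-- inside one summand, and the full homomorphism of that summand carries it back,
-- contradicting that the summand is a 2-cograph.  In a 1-sum the same works unless H meets
-- both G₁ - x and G₂ - y; but every edge out of G₁ - x ends at the merged vertex, which is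
-- then a cut vertex of H.

module Submission where

open import Defs
open import Data.Nat using (suc; zero; _+_)
open import Data.Fin using (Fin; zero; splitAt; punchIn; punchOut; _↑ˡ_; _↑ʳ_; _≟_)
open import Data.Fin.Properties
  using (splitAt-↑ˡ; splitAt-↑ʳ; splitAt⁻¹-↑ˡ; splitAt⁻¹-↑ʳ;
         punchInᵢ≢i; punchIn-punchOut; punchOut-punchIn; punchOut-cong)
open import Data.Product using (∃; _×_; _,_; proj₁; proj₂)
open import Data.Sum using (_⊎_; inj₁; inj₂; fromInj₁)
open import Data.Empty using (⊥; ⊥-elim)
open import Data.Bool using (true; false; not)
open import Function using (_∘_)
open import Function.Definitions using (Injective)
open import Relation.Nullary using (¬_; yes; no; ¬¬-excluded-middle)
open import Relation.Binary.PropositionalEquality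
  using (_≡_; _≢_; refl; sym; trans; cong; cong₂; subst)

Image : ∀ {A B : Set} → (A → B) → B → Set
Image e v = ∃ λ u → e u ≡ v

Obstruction : ∀ {m n} → Graph n → (Fin m → Fin n) → Set
Obstruction G f =
  Injective _≡_ _≡_ f × TwoConnected (induced G f) × TwoConnected (complement (induced G f))

infix 4 _≈ᴳ_
record _≈ᴳ_ {n} (H H′ : Graph n) : Set where
  constructor mk≈ᴳ
  field adj-≡ : ∀ i j → adj H i j ≡ adj H′ i j
open _≈ᴳ_

≈ᴳ-sym : ∀ {n} {H H′ : Graph n} → H ≈ᴳ H′ → H′ ≈ᴳ H
≈ᴳ-sym H≈H′ = mk≈ᴳ λ i j → sym (adj-≡ H≈H′ i j)

delete-resp-≈ᴳ : ∀ {n} {H H′ : Graph (suc n)} → H ≈ᴳ H′ → ∀ c → delete H c ≈ᴳ delete H′ c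
delete-resp-≈ᴳ H≈H′ c = mk≈ᴳ λ i j → adj-≡ H≈H′ (punchIn c i) (punchIn c j)

complement-resp-≈ᴳ : ∀ {n} {H H′ : Graph n} → H ≈ᴳ H′ → complement H ≈ᴳ complement H′
complement-resp-≈ᴳ {H = H} {H′} H≈H′ = mk≈ᴳ same
  where
  same : ∀ i j → adj (complement H) i j ≡ adj (complement H′) i j
  same i j with i ≟ j
  ... | yes _ = refl
  ... | no _  = cong not (adj-≡ H≈H′ i j)

Reachable-resp-≈ᴳ : ∀ {n} {H H′ : Graph n} → H ≈ᴳ H′ → ∀ {u v} → Reachable H u v → Reachable H′ u v
Reachable-resp-≈ᴳ H≈H′ here = here
Reachable-resp-≈ᴳ H≈H′ (step {u} {v} uv r) =
  step (trans (sym (adj-≡ H≈H′ u v)) uv) (Reachable-resp-≈ᴳ H≈H′ r)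

TwoConnected-resp-≈ᴳ : ∀ {n} {H H′ : Graph n} → H ≈ᴳ H′ → TwoConnected H → TwoConnected H′
TwoConnected-resp-≈ᴳ {zero} _ ()
TwoConnected-resp-≈ᴳ {suc _} H≈H′ (three , connected , no-cut) =
  three ,
  (λ u v → Reachable-resp-≈ᴳ H≈H′ (connected u v)) ,
  λ { c (u , w , reach , ¬reach) →
        no-cut c (u , w , Reachable-resp-≈ᴳ (≈ᴳ-sym H≈H′) reach ,
                  ¬reach ∘ Reachable-resp-≈ᴳ (delete-resp-≈ᴳ H≈H′ c)) }

record FullHom {k n} (F : Graph k) (G : Graph n) : Set where
  constructor fullHom
  field
    vertex        : Fin k → Fin n
    adj-preserved : ∀ u v → adj G (vertex u) (vertex v) ≡ adj F u v
open FullHom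

obstruction-in-image⇒¬TwoCograph :
  ∀ {k m n} {F : Graph k} {G : Graph n} {f : Fin m → Fin n} (φ : FullHom F G) →
  (∀ i → Image (vertex φ) (f i)) → Obstruction G f → ¬ TwoCograph F
obstruction-in-image⇒¬TwoCograph {k} {m} {F = F} {G} {f} φ f⊆φ (f-inj , H-2c , H̄-2c) F-2cograph =
  F-2cograph (_ , g , g-inj , TwoConnected-resp-≈ᴳ H≈ H-2c ,
              TwoConnected-resp-≈ᴳ (complement-resp-≈ᴳ H≈) H̄-2c)
  where
  g : Fin m → Fin k
  g i = proj₁ (f⊆φ i)
  φg≡f : ∀ i → vertex φ (g i) ≡ f i
  φg≡f i = proj₂ (f⊆φ i)
  g-inj : Injective _≡_ _≡_ g
  g-inj {i} {j} gi≡gj = f-inj (trans (sym (φg≡f i)) (trans (cong (vertex φ) gi≡gj) (φg≡f j)))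
  H≈ : induced G f ≈ᴳ induced F g
  H≈ = mk≈ᴳ λ i j → trans (sym (cong₂ (adj G) (φg≡f i) (φg≡f j))) (adj-preserved φ (g i) (g j))

Reachable-exit : ∀ {n} {H : Graph n} {P Q : Fin n → Set} →
  (∀ {u v} → adj H u v ≡ true → P u → P v ⊎ Q v) →
  ∀ {u v} → Reachable H u v → P u → P v ⊎ ∃ Q
Reachable-exit leave here Pu = inj₁ Pu
Reachable-exit leave (step uv r) Pu with leave uv Pu
... | inj₁ Pw = Reachable-exit leave r Pw
... | inj₂ Qw = inj₂ (_ , Qw)

Connected-closed : ∀ {n} {H : Graph n} {P : Fin n → Set} → Connected H →
  (∀ {u v} → adj H u v ≡ true → P u → P v) → ∀ {u} → P u → ∀ v → P v
Connected-closed connected closed {u} Pu v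
  with Reachable-exit {Q = λ _ → ⊥} (λ uv → inj₁ ∘ closed uv) (connected u v) Pu
... | inj₁ Pv = Pv

-- The vertex of Q is a cut vertex separating P from the vertices outside P ∪ Q.
separator⇒¬TwoConnected : ∀ {n} {H : Graph n} {P Q : Fin n → Set} →
  (∀ {u v} → adj H u v ≡ true → P u → P v ⊎ Q v) →
  (∀ {c d} → Q c → Q d → c ≡ d) → (∀ {v} → P v → ¬ Q v) →
  ∀ {p q} → P p → ¬ P q → ¬ Q q → ¬ TwoConnected H
separator⇒¬TwoConnected {zero} _ _ _ _ _ _ ()
separator⇒¬TwoConnected {suc _} {H} {P} {Q} leave Q-unique P∩Q=∅ {p} {q} p∈P q∉P q∉Q
  (_ , connected , no-cut) with Reachable-exit leave (connected p q) p∈P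
... | inj₁ q∈P = q∉P q∈P
... | inj₂ (c , c∈Q) = no-cut c (punchOut c≢p , punchOut c≢q , connected _ _ , ¬reach)
  where
  c≢p : c ≢ p
  c≢p refl = P∩Q=∅ p∈P c∈Q
  c≢q : c ≢ q
  c≢q refl = q∉Q c∈Q
  ¬reach : ¬ Reachable (delete H c) (punchOut c≢p) (punchOut c≢q)
  ¬reach r with Reachable-exit {P = P ∘ punchIn c} {Q = Q ∘ punchIn c} leave r
                  (subst P (sym (punchIn-punchOut c≢p)) p∈P)
  ... | inj₁ q′∈P = q∉P (subst P (punchIn-punchOut c≢q) q′∈P)
  ... | inj₂ (d , d∈Q) = punchInᵢ≢i c d (Q-unique d∈Q c∈Q)

↑ˡ-or-↑ʳ : ∀ n₁ {n₂} (v : Fin (n₁ + n₂)) → Image (_↑ˡ n₂) v ⊎ Image (n₁ ↑ʳ_) v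
↑ˡ-or-↑ʳ n₁ v with splitAt n₁ v in eq
... | inj₁ a = inj₁ (a , splitAt⁻¹-↑ˡ eq)
... | inj₂ b = inj₂ (b , splitAt⁻¹-↑ʳ eq)

↑ˡ≢↑ʳ : ∀ {n₁ n₂} (a : Fin n₁) (b : Fin n₂) → a ↑ˡ n₂ ≢ n₁ ↑ʳ b
↑ˡ≢↑ʳ {n₁} {n₂} a b eq with trans (sym (splitAt-↑ˡ n₁ a n₂)) (trans (cong (splitAt n₁) eq) (splitAt-↑ʳ n₁ n₂ b))
... | ()

module _ {n₁ n₂} (G₁ : Graph n₁) (G₂ : Graph n₂) where

  zeroSum-adj-↑ˡ : ∀ a a′ → adj (zeroSum G₁ G₂) (a ↑ˡ n₂) (a′ ↑ˡ n₂) ≡ adj G₁ a a′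
  zeroSum-adj-↑ˡ a a′ rewrite splitAt-↑ˡ n₁ a n₂ | splitAt-↑ˡ n₁ a′ n₂ = refl

  zeroSum-adj-↑ʳ : ∀ b b′ → adj (zeroSum G₁ G₂) (n₁ ↑ʳ b) (n₁ ↑ʳ b′) ≡ adj G₂ b b′
  zeroSum-adj-↑ʳ b b′ rewrite splitAt-↑ʳ n₁ n₂ b | splitAt-↑ʳ n₁ n₂ b′ = refl

  zeroSum-↑ˡ : FullHom G₁ (zeroSum G₁ G₂)
  zeroSum-↑ˡ = fullHom (_↑ˡ n₂) zeroSum-adj-↑ˡ

  zeroSum-↑ʳ : FullHom G₂ (zeroSum G₁ G₂)
  zeroSum-↑ʳ = fullHom (n₁ ↑ʳ_) zeroSum-adj-↑ʳ

  zeroSum-adj-↑ˡ-↑ʳ : ∀ a b → adj (zeroSum G₁ G₂) (a ↑ˡ n₂) (n₁ ↑ʳ b) ≡ false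
  zeroSum-adj-↑ˡ-↑ʳ a b rewrite splitAt-↑ˡ n₁ a n₂ | splitAt-↑ʳ n₁ n₂ b = refl

module _ {n₁ n₂} {G₁ : Graph n₁} {G₂ : Graph n₂} where

  zeroSum-left-closed : ∀ {u v} → adj (zeroSum G₁ G₂) u v ≡ true →
    Image (_↑ˡ n₂) u → Image (_↑ˡ n₂) v
  zeroSum-left-closed {v = v} uv (a , refl) with ↑ˡ-or-↑ʳ n₁ v
  ... | inj₁ v∈left = v∈left
  ... | inj₂ (b , refl) with () ← trans (sym uv) (zeroSum-adj-↑ˡ-↑ʳ G₁ G₂ a b)

  zeroSum-right-closed : ∀ {u v} → adj (zeroSum G₁ G₂) u v ≡ true →
    Image (n₁ ↑ʳ_) u → Image (n₁ ↑ʳ_) v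
  zeroSum-right-closed {v = v} uv (b , refl) with ↑ˡ-or-↑ʳ n₁ v
  ... | inj₂ v∈right = v∈right
  ... | inj₁ (a , refl)
    with () ← trans (sym uv) (trans (adj-sym (zeroSum G₁ G₂) _ _) (zeroSum-adj-↑ˡ-↑ʳ G₁ G₂ a b))

pivot-or-punchIn : ∀ {m} (y j : Fin (suc m)) → y ≡ j ⊎ Image (punchIn y) j
pivot-or-punchIn y j with y ≟ j
... | yes y≡j = inj₁ y≡j
... | no y≢j  = inj₂ (punchOut y≢j , punchIn-punchOut y≢j)

module _ {n₁ m₂} (x : Fin n₁) (y : Fin (suc m₂)) where

  embed₂ : Fin (suc m₂) → Fin (n₁ + m₂)
  embed₂ j with y ≟ j
  ... | yes _   = x ↑ˡ m₂
  ... | no y≢j  = n₁ ↑ʳ punchOut y≢j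

  embed₂-pivot : embed₂ y ≡ x ↑ˡ m₂
  embed₂-pivot with y ≟ y
  ... | yes _   = refl
  ... | no y≢y  = ⊥-elim (y≢y refl)

  embed₂-punchIn : ∀ b → embed₂ (punchIn y b) ≡ n₁ ↑ʳ b
  embed₂-punchIn b with y ≟ punchIn y b
  ... | yes y≡b = ⊥-elim (punchInᵢ≢i y b (sym y≡b))
  ... | no _    = cong (n₁ ↑ʳ_) (trans (punchOut-cong y refl) (punchOut-punchIn y))

  LeftOnly : Fin (n₁ + m₂) → Set
  LeftOnly v = Image (_↑ˡ m₂) v × v ≢ x ↑ˡ m₂

  ¬LeftOnly⇒image-embed₂ : ∀ {v} → ¬ LeftOnly v → Image embed₂ v
  ¬LeftOnly⇒image-embed₂ {v} ¬left with ↑ˡ-or-↑ʳ n₁ v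
  ... | inj₂ (b , b↑≡v) = punchIn y b , trans (embed₂-punchIn b) b↑≡v
  ... | inj₁ v∈left with v ≟ x ↑ˡ m₂
  ...   | yes v≡x = y , trans embed₂-pivot (sym v≡x)
  ...   | no v≢x  = ⊥-elim (¬left (v∈left , v≢x))

  right⇒¬LeftOnly : ∀ {v} → Image (n₁ ↑ʳ_) v → ¬ LeftOnly v
  right⇒¬LeftOnly (b , b↑≡v) ((a , a↑≡v) , _) = ↑ˡ≢↑ʳ a b (trans a↑≡v (sym b↑≡v))

  right⇒≢x : ∀ {v} → Image (n₁ ↑ʳ_) v → v ≢ x ↑ˡ m₂
  right⇒≢x (b , b↑≡v) v≡x = ↑ˡ≢↑ʳ x b (trans (sym v≡x) (sym b↑≡v))

module _ {n₁ m₂} (G₁ : Graph n₁) (G₂ : Graph (suc m₂)) (x : Fin n₁) (y : Fin (suc m₂)) where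

  private
    G = oneSum G₁ G₂ x y

  oneSum-adj-↑ˡ : ∀ a a′ → adj G (a ↑ˡ m₂) (a′ ↑ˡ m₂) ≡ adj G₁ a a′
  oneSum-adj-↑ˡ a a′ rewrite splitAt-↑ˡ n₁ a m₂ | splitAt-↑ˡ n₁ a′ m₂ = refl

  oneSum-↑ˡ : FullHom G₁ G
  oneSum-↑ˡ = fullHom (_↑ˡ m₂) oneSum-adj-↑ˡ

  oneSum-adj-↑ʳ : ∀ b b′ → adj G (n₁ ↑ʳ b) (n₁ ↑ʳ b′) ≡ adj G₂ (punchIn y b) (punchIn y b′)
  oneSum-adj-↑ʳ b b′ rewrite splitAt-↑ʳ n₁ m₂ b | splitAt-↑ʳ n₁ m₂ b′ = refl

  oneSum-adj-x-↑ʳ : ∀ b → adj G (x ↑ˡ m₂) (n₁ ↑ʳ b) ≡ adj G₂ y (punchIn y b)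
  oneSum-adj-x-↑ʳ b rewrite splitAt-↑ˡ n₁ x m₂ | splitAt-↑ʳ n₁ m₂ b with x ≟ x
  ... | yes _  = refl
  ... | no x≢x = ⊥-elim (x≢x refl)

  oneSum-adj-↑ˡ-↑ʳ : ∀ {a} b → a ≢ x → adj G (a ↑ˡ m₂) (n₁ ↑ʳ b) ≡ false
  oneSum-adj-↑ˡ-↑ʳ {a} b a≢x rewrite splitAt-↑ˡ n₁ a m₂ | splitAt-↑ʳ n₁ m₂ b with a ≟ x
  ... | yes a≡x = ⊥-elim (a≢x a≡x)
  ... | no _    = refl

  embed₂-adj : ∀ u v → adj G (embed₂ x y u) (embed₂ x y v) ≡ adj G₂ u v
  embed₂-adj u v with pivot-or-punchIn y u | pivot-or-punchIn y v
  ... | inj₁ refl       | inj₁ refl = trans (adj-irrefl G _) (sym (adj-irrefl G₂ y))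
  ... | inj₁ refl       | inj₂ (b , refl)
    rewrite embed₂-pivot x y | embed₂-punchIn x y b = oneSum-adj-x-↑ʳ b
  ... | inj₂ (a , refl) | inj₁ refl
    rewrite embed₂-pivot x y | embed₂-punchIn x y a =
      trans (adj-sym G _ _) (trans (oneSum-adj-x-↑ʳ a) (adj-sym G₂ _ _))
  ... | inj₂ (a , refl) | inj₂ (b , refl)
    rewrite embed₂-punchIn x y a | embed₂-punchIn x y b = oneSum-adj-↑ʳ a b

  oneSum-embed₂ : FullHom G₂ G
  oneSum-embed₂ = fullHom (embed₂ x y) embed₂-adj

  oneSum-leaves-LeftOnly : ∀ {u v} → adj G u v ≡ true → LeftOnly x y u → LeftOnly x y v ⊎ v ≡ x ↑ˡ m₂
  oneSum-leaves-LeftOnly {v = v} uv ((a , refl) , a↑≢x) with ↑ˡ-or-↑ʳ n₁ v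
  ... | inj₂ (b , refl) with () ← trans (sym uv) (oneSum-adj-↑ˡ-↑ʳ b (a↑≢x ∘ cong (_↑ˡ m₂)))
  ... | inj₁ v∈left with v ≟ x ↑ˡ m₂
  ...   | yes v≡x = inj₂ v≡x
  ...   | no v≢x  = inj₁ (v∈left , v≢x)

zeroSum-TwoCograph : ∀ {n₁ n₂} (G₁ : Graph n₁) (G₂ : Graph n₂) →
  TwoCograph G₁ → TwoCograph G₂ → TwoCograph (zeroSum G₁ G₂)
zeroSum-TwoCograph G₁ G₂ _ _ (zero , _ , _ , () , _)
zeroSum-TwoCograph {n₁} {n₂} G₁ G₂ G₁-2cograph G₂-2cograph
  (suc _ , f , obstruction@(_ , (_ , connected , _) , _)) with ↑ˡ-or-↑ʳ n₁ (f zero)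
... | inj₁ f₀∈left =
  obstruction-in-image⇒¬TwoCograph (zeroSum-↑ˡ G₁ G₂)
    (Connected-closed connected (λ {u} {v} → zeroSum-left-closed {u = f u} {f v}) f₀∈left)
    obstruction G₁-2cograph
... | inj₂ f₀∈right =
  obstruction-in-image⇒¬TwoCograph (zeroSum-↑ʳ G₁ G₂)
    (Connected-closed connected (λ {u} {v} → zeroSum-right-closed {u = f u} {f v}) f₀∈right)
    obstruction G₂-2cograph

-- The goal is ⊥, so it is harmless to decide classically whether the obstruction meets
-- G₁ - x and G₂ - y.
oneSum-TwoCograph : ∀ {n₁ m₂} (G₁ : Graph n₁) (G₂ : Graph (suc m₂)) (x : Fin n₁) (y : Fin (suc m₂)) →
  TwoCograph G₁ → TwoCograph G₂ → TwoCograph (oneSum G₁ G₂ x y)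
oneSum-TwoCograph {n₁} {m₂} G₁ G₂ x y G₁-2cograph G₂-2cograph (_ , f , obstruction@(f-inj , H-2c , _)) =
  ¬¬-excluded-middle λ where
    (no no-left-only) →
      obstruction-in-image⇒¬TwoCograph (oneSum-embed₂ G₁ G₂ x y)
        (λ i → ¬LeftOnly⇒image-embed₂ x y (no-left-only ∘ (i ,_))) obstruction G₂-2cograph
    (yes (p , p-left-only)) → ¬¬-excluded-middle λ where
      (no no-right-only) →
        obstruction-in-image⇒¬TwoCograph (oneSum-↑ˡ G₁ G₂ x y)
          (λ i → fromInj₁ (λ r → ⊥-elim (no-right-only (i , r))) (↑ˡ-or-↑ʳ n₁ (f i)))
          obstruction G₁-2cograph
      (yes (q , q-right)) →
        separator⇒¬TwoConnected {P = LeftOnly x y ∘ f} {Q = λ i → f i ≡ x ↑ˡ m₂}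
          (λ {u} {v} → oneSum-leaves-LeftOnly G₁ G₂ x y {f u} {f v})
          (λ c≡x d≡x → f-inj (trans c≡x (sym d≡x))) proj₂
          p-left-only (right⇒¬LeftOnly x y q-right) (right⇒≢x x y q-right) H-2c

lemma2p2 :
    (∀ {n₁ n₂} (G₁ : Graph n₁) (G₂ : Graph n₂) →
      TwoCograph G₁ → TwoCograph G₂ → TwoCograph (zeroSum G₁ G₂))
    ×
    (∀ {n₁ m₂} (G₁ : Graph n₁) (G₂ : Graph (suc m₂)) (x : Fin n₁) (y : Fin (suc m₂)) →
      TwoCograph G₁ → TwoCograph G₂ → TwoCograph (oneSum G₁ G₂ x y))
lemma2p2 = zeroSum-TwoCograph , oneSum-TwoCograph
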